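{- There exists $d_0$ such that for every $d\ge d_0$ and every $n\ge d+2$, the tree obtained by identifying the center of the star $K_{1,n-d-1}$ (of order $n-d$) with a central vertex of a path with $d$ edges does not attain the maximum value of $I_{ecc}$ among all trees of order $n$ and diameter $d$.
   Context: $\log$ is base $2$. The eccentricity of a vertex $v$ is $ecc(v)=\max_u d(v,u)$ and the diameter is the maximum eccentricity. For a connected graph $G$ with vertices $v_1,\dots,v_n$, $I_{ecc}(G)=-\sum_{i=1}^n\frac{ecc(v_i)}{\sum_{j} ecc(v_j)}\log\left(\frac{ecc(v_i)}{\sum_{j} ecc(v_j)}\right)$. A central vertex of a path with $d$ edges is a vertex at distance $\lfloor d/2\rfloor$ or $\lceil d/2\rceil$ from an end vertex. -}

module Defs where

open import Data.Nat.Base using (ℕ; zero; suc; _+_; _*_; _^_; _≤_; _<_; _⊔_; _/_; _≡ᵇ_; _<ᵇ_; _≤ᵇ_)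
open import Data.Bool.Base using (Bool; true; false; _∧_; _∨_; if_then_else_)
open import Data.Fin.Base using (Fin; toℕ)
open import Data.Fin.Properties using (_≟_)
open import Data.List.Base using (List; []; _∷_; _∷ʳ_; length; map; foldr; allFin)
open import Data.Bool.ListAction using (any)
open import Data.Nat.ListAction using (sum; product)
open import Data.List.Relation.Unary.Unique.Propositional using (Unique)
open import Data.Product.Base using (Σ; _×_)
open import Data.Unit.Base using (⊤)
open import Relation.Nullary.Decidable.Core using (⌊_⌋)
open import Relation.Binary.PropositionalEquality using (_≡_)

Graph : ℕ → Set
Graph n = Fin n → Fin n → Bool

IsSimple : ∀ {n} → Graph n → Set
IsSimple {n} G = ((u v : Fin n) → G u v ≡ G v u) × ((v : Fin n) → G v v ≡ false)

reach : ∀ {n} → Graph n → ℕ → Fin n → Fin n → Bool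
reach {n} G zero u v = ⌊ u ≟ v ⌋
reach {n} G (suc k) u v = reach G k u v ∨ any (λ w → reach G k u w ∧ G w v) (allFin n)

Connected : ∀ {n} → Graph n → Set
Connected {n} G = (u v : Fin n) → reach G n u v ≡ true

Linked : ∀ {n} → Graph n → List (Fin n) → Set
Linked G (a ∷ b ∷ r) = (G a b ≡ true) × Linked G (b ∷ r)
Linked G _ = ⊤

HasCycle : ∀ {n} → Graph n → Set
HasCycle {n} G = Σ (Fin n) λ x → Σ (List (Fin n)) λ rest →
  (3 ≤ length (x ∷ rest)) × Unique (x ∷ rest) × Linked G ((x ∷ rest) ∷ʳ x)

IsTree : ∀ {n} → Graph n → Set
IsTree G = IsSimple G × Connected G × (HasCycle G → Data.Empty.⊥)
  where import Data.Empty

-- distance: least k with a walk of length ≤ k (search with fuel n; exact for connected graphs)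
distSearch : ∀ {n} → Graph n → Fin n → Fin n → ℕ → ℕ → ℕ
distSearch G u v k zero = k
distSearch G u v k (suc f) = if reach G k u v then k else distSearch G u v (suc k) f

dist : ∀ {n} → Graph n → Fin n → Fin n → ℕ
dist {n} G u v = distSearch G u v 0 n

maximum : List ℕ → ℕ
maximum = foldr _⊔_ 0

ecc : ∀ {n} → Graph n → Fin n → ℕ
ecc {n} G v = maximum (map (λ u → dist G v u) (allFin n))

diameter : ∀ {n} → Graph n → ℕ
diameter {n} G = maximum (map (ecc G) (allFin n))

eccSum : ∀ {n} → Graph n → ℕ
eccSum {n} G = sum (map (ecc G) (allFin n))

eccPowProd : ∀ {n} → Graph n → ℕ
eccPowProd {n} G = product (map (λ v → ecc G v ^ ecc G v) (allFin n))

-- I_ecc(G) = log S - (1/S) Σ e_v log e_v = log S - (log P)/S   (log base 2).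
-- Since x ↦ 2^x is strictly increasing, for S, S' > 0:
--   I_ecc(G) < I_ecc(H)  ⇔  S_G S_H I_ecc(G) < S_G S_H I_ecc(H)
--                         ⇔  S_G^(S_G S_H) · P_H^(S_G)  <  S_H^(S_G S_H) · P_G^(S_H)
-- This is the exact natural-number form of the real comparison.
_IeccLt_ : ∀ {n} → Graph n → Graph n → Set
G IeccLt H =
  eccSum G ^ (eccSum G * eccSum H) * eccPowProd H ^ eccSum G
    < eccSum H ^ (eccSum G * eccSum H) * eccPowProd G ^ eccSum H

-- The tree on n vertices: path 0 - 1 - ... - d, with vertices d+1, ..., n-1
-- all adjacent to the central vertex ⌊d/2⌋ (star K_{1,n-d-1} with center identified
-- with a central vertex of the path).
starPath : (n d : ℕ) → Graph n
starPath n d i j =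
  ((a ≤ᵇ d) ∧ (b ≤ᵇ d) ∧ ((suc a ≡ᵇ b) ∨ (suc b ≡ᵇ a)))
  ∨ ((a ≡ᵇ c) ∧ (d <ᵇ b))
  ∨ ((b ≡ᵇ c) ∧ (d <ᵇ a))
  where
    a = toℕ i
    b = toℕ j
    c = d / 2

{-# OPTIONS --safe #-}
-- Let T_c be the path 0 – 1 – ⋯ – d with the other n − d − 1 vertices attached to c, and
-- h = ⌊d/2⌋, so that starPath n d is T_h.  We show I_ecc(T_h) < I_ecc(T_(h−1)).  In T_c the
-- path vertex x has eccentricity max(x, d − x) and each of the m = n − d − 1 pendant vertices
-- has 1 + max(c, d − c): this is e = ⌈d/2⌉ + 1 for c = h and e + 1 for c = h − 1.  With
-- S = Σ ecc and P = Π ecc^ecc we have I_ecc = log S − (log P)/S.  Weighted AM–GM shows that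
-- raising m entries from e to e + 1 increases this quantity as soon as (e + 1)^A < Q, where
-- A = Σ max(x, d − x) and Q = Π max(x, d − x)^max(x, d − x) come from the path.  Gibbs'
-- inequality gives Q ≥ (A/(d + 1))^A, and A ≈ 3d²/4 exceeds (e + 1)(d + 1) ≈ d²/2 once d ≥ 10.
module Submission where

open import Defs
open import Data.Bool.Base using (true; false; if_then_else_; _∧_; _∨_; T)
open import Data.Bool.Properties using (T-≡; T-∨; T-∧)
open import Data.Empty using (⊥)
open import Data.Fin.Base using (Fin; toℕ; fromℕ<)
open import Data.Fin.Properties using (toℕ-fromℕ<; toℕ-injective; toℕ<n) renaming (_≟_ to _≟ᶠ_)
open import Data.List.Base
  using (List; []; _∷_; _++_; _∷ʳ_; length; replicate; map; applyUpTo; tabulate; allFin)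
open import Data.List.Properties
  using (length-++; length-replicate; map-tabulate; map-applyUpTo; applyUpTo-∷ʳ; length-applyUpTo;
         map-cong; map-++; map-∘; map-replicate)
open import Data.List.Membership.Propositional using (_∈_)
open import Data.List.Membership.Propositional.Properties using (∈-allFin; ∈-++⁺ʳ)
open import Data.List.Relation.Unary.All as All using (All; []; _∷_)
open import Data.List.Relation.Unary.AllPairs using (_∷_)
open import Data.List.Relation.Unary.Any using (here; there; satisfied)
open import Data.List.Relation.Unary.Any.Properties using (any⁺; any⁻; tabulate⁺)
open import Data.List.Relation.Unary.Unique.Propositional using (Unique)
open import Data.Nat.Base
open import Data.Nat.DivMod using (m≡m%n+[m/n]*n; m%n<n; /-monoˡ-≤)
open import Data.Nat.ListAction using (sum; product)
open import Data.Nat.ListAction.Properties using (sum-++; product-++)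
open import Data.Nat.Properties
open import Data.Nat.Tactic.RingSolver using (solve-∀)
open import Data.Product.Base using (Σ; ∃-syntax; _×_; _,_; proj₁; proj₂)
open import Data.Sum.Base using (_⊎_; inj₁; inj₂; [_,_]; swap)
import Data.Sum.Base as Sum
open import Data.Unit.Base using (⊤)
open import Function.Base using (_∘_; id)
open import Function.Bundles using (Equivalence; mk⇔)
open import Relation.Binary.Definitions using (tri<; tri≈; tri>)
open import Relation.Binary.PropositionalEquality hiding ([_])
open import Relation.Nullary using (¬_; Dec; does; yes; no; contradiction)
open import Relation.Nullary.Decidable
  using (proof; dec-true; dec-false; does-⇔; toWitness; fromWitness; _×-dec_; _⊎-dec_)
open import Relation.Nullary.Reflects using (Reflects; invert)
import Algebra.Properties.CommutativeSemigroup *-commutativeSemigroup as *-CS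
import Algebra.Properties.CommutativeSemigroup +-commutativeSemigroup as +-CS

open Equivalence using (to; from)

-- AM–GM and Gibbs' inequality over ℕ

^-distribʳ-* : ∀ m n o → (m * n) ^ o ≡ m ^ o * n ^ o
^-distribʳ-* m n zero    = refl
^-distribʳ-* m n (suc o) =
  trans (cong (m * n *_) (^-distribʳ-* m n o)) (*-CS.interchange m n (m ^ o) (n ^ o))

n^n≢0 : ∀ n → NonZero (n ^ n)
n^n≢0 zero    = _
n^n≢0 (suc n) = m^n≢0 (suc n) (suc n)

2*m*n≤m*m+n*n : ∀ m n → 2 * (m * n) ≤ m * m + n * n
2*m*n≤m*m+n*n zero    n       = z≤n
2*m*n≤m*m+n*n (suc m) zero    = ≤-trans (≤-reflexive (cong (2 *_) (*-zeroʳ (suc m)))) z≤n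
2*m*n≤m*m+n*n (suc m) (suc n) = begin
  2 * (suc m * suc n)                 ≡⟨ expand m n ⟩
  2 * (m * n) + 2 * (m + n + 1)       ≤⟨ +-monoˡ-≤ _ (2*m*n≤m*m+n*n m n) ⟩
  m * m + n * n + 2 * (m + n + 1)     ≡⟨ square-sum m n ⟩
  suc m * suc m + suc n * suc n       ∎
  where
  open ≤-Reasoning
  expand : ∀ m n → 2 * (suc m * suc n) ≡ 2 * (m * n) + 2 * (m + n + 1)
  expand = solve-∀
  square-sum : ∀ m n → m * m + n * n + 2 * (m + n + 1) ≡ suc m * suc m + suc n * suc n
  square-sum = solve-∀

young : ∀ a b k → suc k * (b * a ^ k) ≤ b ^ suc k + k * a ^ suc k
young a b zero    = ≤-reflexive (trans (*-identityˡ (b * 1)) (sym (+-identityʳ (b * 1))))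
young a b (suc k) = +-cancelʳ-≤ (k * (b * a ^ suc k)) _ _ (begin
  suc (suc k) * (b * a ^ suc k) + k * (b * a ^ suc k) ≡⟨ collect a b k (a ^ k) ⟩
  (suc k * a ^ k) * (2 * (a * b))                     ≤⟨ *-monoʳ-≤ (suc k * a ^ k) (2*m*n≤m*m+n*n a b) ⟩
  (suc k * a ^ k) * (a * a + b * b)                   ≡⟨ split a b k (a ^ k) ⟩
  b * (suc k * (b * a ^ k)) + suc k * a ^ suc (suc k) ≤⟨ +-monoˡ-≤ _ (*-monoʳ-≤ b (young a b k)) ⟩
  b * (b ^ suc k + k * a ^ suc k) + suc k * a ^ suc (suc k)
                                                      ≡⟨ regroup a b k (a ^ k) (b ^ suc k) ⟩
  b ^ suc (suc k) + suc k * a ^ suc (suc k) + k * (b * a ^ suc k) ∎)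
  where
  open ≤-Reasoning
  collect : ∀ a b k p → (2 + k) * (b * (a * p)) + k * (b * (a * p)) ≡ ((1 + k) * p) * (2 * (a * b))
  collect = solve-∀
  split : ∀ a b k p → ((1 + k) * p) * (a * a + b * b) ≡ b * ((1 + k) * (b * p)) + (1 + k) * (a * (a * p))
  split = solve-∀
  regroup : ∀ a b k p q → b * (q + k * (a * p)) + (1 + k) * (a * (a * p))
                        ≡ b * q + (1 + k) * (a * (a * p)) + k * (b * (a * p))
  regroup = solve-∀

-- Young's inequality at a = s (k + 1), b = (x + s) k, divided by k.
amgm-1-k : ∀ k x s → suc k ^ suc k * (x * s ^ k) ≤ k ^ k * (x + s) ^ suc k
amgm-1-k zero      x s = *-monoʳ-≤ 1 (*-monoˡ-≤ 1 (m≤m+n x s))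
amgm-1-k k@(suc _) x s = *-cancelˡ-≤ k (+-cancelʳ-≤ (k * a ^ suc k) _ _ (begin
  k * (suc k ^ suc k * (x * s ^ k)) + k * a ^ suc k
    ≡⟨ cong (λ t → k * (suc k ^ suc k * (x * s ^ k)) + k * t) (^-distribʳ-* s (suc k) (suc k)) ⟩
  k * (suc k ^ suc k * (x * s ^ k)) + k * (s ^ suc k * suc k ^ suc k)
    ≡⟨ expand x s k (s ^ k) (suc k ^ k) ⟩
  suc k * (b * (s ^ k * suc k ^ k))
    ≡⟨ cong (λ t → suc k * (b * t)) (^-distribʳ-* s (suc k) k) ⟨
  suc k * (b * a ^ k)
    ≤⟨ young a b k ⟩
  b ^ suc k + k * a ^ suc k
    ≡⟨ cong (_+ k * a ^ suc k) (trans (^-distribʳ-* (x + s) k (suc k)) (*-comm _ (k ^ suc k))) ⟩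
  k ^ suc k * (x + s) ^ suc k + k * a ^ suc k
    ≡⟨ cong (_+ k * a ^ suc k) (*-assoc k (k ^ k) _) ⟩
  k * (k ^ k * (x + s) ^ suc k) + k * a ^ suc k ∎))
  where
  open ≤-Reasoning
  a b : ℕ
  a = s * suc k
  b = (x + s) * k
  expand : ∀ x s k p q → k * ((1 + k) * q * (x * p)) + k * (s * p * ((1 + k) * q))
                       ≡ (1 + k) * ((x + s) * k * (p * q))
  expand = solve-∀

amgm : ∀ xs → length xs ^ length xs * product xs ≤ sum xs ^ length xs
amgm []       = ≤-refl
amgm (x ∷ xs) = *-cancelʳ-≤ _ _ (k ^ k) {{n^n≢0 k}} (begin
  suc k ^ suc k * (x * product xs) * k ^ k   ≡⟨ rearrange (suc k ^ suc k) x (product xs) (k ^ k) ⟩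
  suc k ^ suc k * (x * (k ^ k * product xs)) ≤⟨ *-monoʳ-≤ (suc k ^ suc k) (*-monoʳ-≤ x (amgm xs)) ⟩
  suc k ^ suc k * (x * sum xs ^ k)           ≤⟨ amgm-1-k k x (sum xs) ⟩
  k ^ k * (x + sum xs) ^ suc k               ≡⟨ *-comm (k ^ k) _ ⟩
  (x + sum xs) ^ suc k * k ^ k               ∎)
  where
  open ≤-Reasoning
  k : ℕ
  k = length xs
  rearrange : ∀ c x p q → c * (x * p) * q ≡ c * (x * (q * p))
  rearrange = solve-∀

sum-replicate : ∀ k v → sum (replicate k v) ≡ k * v
sum-replicate zero    v = refl
sum-replicate (suc k) v = cong (v +_) (sum-replicate k v)

product-replicate : ∀ k v → product (replicate k v) ≡ v ^ k
product-replicate zero    v = refl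
product-replicate (suc k) v = cong (v *_) (product-replicate k v)

-- (x/a)^a (y/b)^b ≤ ((x + y)/(a + b))^(a + b), by AM–GM on a copies of x b and b copies of y a.
weighted-amgm : ∀ a b x y → x ^ a * y ^ b * (a + b) ^ (a + b) ≤ a ^ a * b ^ b * (x + y) ^ (a + b)
weighted-amgm zero b x y = begin
  1 * y ^ b * b ^ b ≡⟨ *-CS.xy∙z≈xz∙y 1 (y ^ b) (b ^ b) ⟩
  1 * b ^ b * y ^ b ≤⟨ *-monoʳ-≤ (1 * b ^ b) (^-monoˡ-≤ b (m≤n+m y x)) ⟩
  1 * b ^ b * (x + y) ^ b ∎
  where open ≤-Reasoning
weighted-amgm a@(suc _) zero x y =
  subst (λ k → x ^ a * 1 * k ^ k ≤ a ^ a * 1 * (x + y) ^ k) (sym (+-identityʳ a)) (begin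
    x ^ a * 1 * a ^ a ≡⟨ *-CS.xy∙z≈zy∙x (x ^ a) 1 (a ^ a) ⟩
    a ^ a * 1 * x ^ a ≤⟨ *-monoʳ-≤ (a ^ a * 1) (^-monoˡ-≤ a (m≤m+n x y)) ⟩
    a ^ a * 1 * (x + y) ^ a ∎)
  where open ≤-Reasoning
weighted-amgm a@(suc _) b@(suc _) x y =
  *-cancelˡ-≤ (a ^ b * b ^ a) {{m*n≢0 _ _ {{m^n≢0 a b}} {{m^n≢0 b a}}}} (begin
  a ^ b * b ^ a * (x ^ a * y ^ b * (a + b) ^ (a + b))
    ≡⟨ shuffle (a ^ b) (b ^ a) (x ^ a) (y ^ b) ((a + b) ^ (a + b)) ⟩
  (a + b) ^ (a + b) * ((x ^ a * b ^ a) * (y ^ b * a ^ b))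
    ≡⟨ cong₂ (λ u v → (a + b) ^ (a + b) * (u * v)) (^-distribʳ-* x b a) (^-distribʳ-* y a b) ⟨
  (a + b) ^ (a + b) * ((x * b) ^ a * (y * a) ^ b)
    ≤⟨ subst₂ _≤_ (cong₂ (λ k p → k ^ k * p) length-xs product-xs) (cong₂ _^_ sum-xs length-xs)
                 (amgm xs) ⟩
  (a * b * (x + y)) ^ (a + b)
    ≡⟨ ^-distribʳ-* (a * b) (x + y) (a + b) ⟩
  (a * b) ^ (a + b) * (x + y) ^ (a + b)
    ≡⟨ cong (_* (x + y) ^ (a + b)) (trans (^-distribʳ-* a b (a + b))
                                     (cong₂ _*_ (^-distribˡ-+-* a a b) (^-distribˡ-+-* b a b))) ⟩
  (a ^ a * a ^ b) * (b ^ a * b ^ b) * (x + y) ^ (a + b)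
    ≡⟨ regroup (a ^ a) (a ^ b) (b ^ a) (b ^ b) ((x + y) ^ (a + b)) ⟩
  a ^ b * b ^ a * (a ^ a * b ^ b * (x + y) ^ (a + b)) ∎)
  where
  open ≤-Reasoning
  xs : List ℕ
  xs = replicate a (x * b) ++ replicate b (y * a)
  length-xs : length xs ≡ a + b
  length-xs = trans (length-++ (replicate a (x * b))) (cong₂ _+_ (length-replicate a) (length-replicate b))
  product-xs : product xs ≡ (x * b) ^ a * (y * a) ^ b
  product-xs = trans (product-++ (replicate a (x * b)) _)
                     (cong₂ _*_ (product-replicate a (x * b)) (product-replicate b (y * a)))
  sum-xs : sum xs ≡ a * b * (x + y)
  sum-xs = trans (sum-++ (replicate a (x * b)) _)
                 (trans (cong₂ _+_ (sum-replicate a (x * b)) (sum-replicate b (y * a))) (factor a b x y))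
    where
    factor : ∀ a b x y → a * (x * b) + b * (y * a) ≡ a * b * (x + y)
    factor = solve-∀
  shuffle : ∀ p q r s t → p * q * (r * s * t) ≡ t * ((r * q) * (s * p))
  shuffle = solve-∀
  regroup : ∀ p q r s t → (p * q) * (r * s) * t ≡ q * r * (p * s * t)
  regroup = solve-∀

selfPowProduct : List ℕ → ℕ
selfPowProduct xs = product (map (λ x → x ^ x) xs)

length^sum≢0 : ∀ xs → NonZero (length xs ^ sum xs)
length^sum≢0 []       = _
length^sum≢0 (x ∷ xs) = m^n≢0 (length (x ∷ xs)) (sum (x ∷ xs))

-- With p_i = x_i / Σ x, this is Gibbs' inequality H(p) ≤ log (length xs).
entropy≤log-length : ∀ xs → sum xs ^ sum xs ≤ selfPowProduct xs * length xs ^ sum xs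
entropy≤log-length []       = ≤-refl
entropy≤log-length (x ∷ xs) = *-cancelˡ-≤ (k ^ s) {{length^sum≢0 xs}} (begin
  k ^ s * (x + s) ^ (x + s)              ≡⟨ cong (_* (x + s) ^ (x + s)) (*-identityˡ (k ^ s)) ⟨
  1 * k ^ s * (x + s) ^ (x + s)          ≡⟨ cong (λ u → u * k ^ s * (x + s) ^ (x + s)) (^-zeroˡ x) ⟨
  1 ^ x * k ^ s * (x + s) ^ (x + s)      ≤⟨ weighted-amgm x s 1 k ⟩
  x ^ x * s ^ s * (1 + k) ^ (x + s)      ≤⟨ *-monoˡ-≤ _ (*-monoʳ-≤ (x ^ x) (entropy≤log-length xs)) ⟩
  x ^ x * (Q * k ^ s) * suc k ^ (x + s)  ≡⟨ shuffle (x ^ x) Q (k ^ s) (suc k ^ (x + s)) ⟩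
  k ^ s * (x ^ x * Q * suc k ^ (x + s))  ∎)
  where
  open ≤-Reasoning
  k s Q : ℕ
  k = length xs
  s = sum xs
  Q = selfPowProduct xs
  shuffle : ∀ p q r t → p * (q * r) * t ≡ r * (p * q * t)
  shuffle = solve-∀

e^sum<selfPowProduct : ∀ e xs → e * length xs < sum xs → e ^ sum xs < selfPowProduct xs
e^sum<selfPowProduct e xs eN<A = *-cancelʳ-< _ _ _ (begin-strict
  e ^ A * N ^ A               ≡⟨ ^-distribʳ-* e N A ⟨
  (e * N) ^ A                 <⟨ ^-monoˡ-< A {{>-nonZero (m<n⇒0<n eN<A)}} eN<A ⟩
  A ^ A                       ≤⟨ entropy≤log-length xs ⟩
  selfPowProduct xs * N ^ A   ∎)
  where
  open ≤-Reasoning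
  A N : ℕ
  A = sum xs
  N = length xs

weighted-amgm-shift : ∀ A m e → suc e ^ (m * e) * (A + m * e) ^ (A + m * e)
                              ≤ e ^ (m * e) * (A + m * suc e) ^ (A + m * e)
weighted-amgm-shift A m e = *-cancelˡ-≤ (A ^ A * m ^ me) {{m*n≢0 _ _ {{n^n≢0 A}} {{m^[m*e]≢0 m}}}} (begin
  A ^ A * m ^ me * (X ^ me * SG ^ SG)  ≡⟨ regroup (A ^ A) (m ^ me) (X ^ me) (SG ^ SG) ⟩
  A ^ A * (m ^ me * X ^ me) * SG ^ SG  ≡⟨ cong (λ u → A ^ A * u * SG ^ SG) (^-distribʳ-* m X me) ⟨
  A ^ A * (m * X) ^ me * SG ^ SG       ≤⟨ weighted-amgm A me A (m * X) ⟩
  A ^ A * me ^ me * SH ^ SG            ≡⟨ cong (λ u → A ^ A * u * SH ^ SG) (^-distribʳ-* m e me) ⟩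
  A ^ A * (m ^ me * e ^ me) * SH ^ SG  ≡⟨ regroup (A ^ A) (m ^ me) (e ^ me) (SH ^ SG) ⟨
  A ^ A * m ^ me * (e ^ me * SH ^ SG)  ∎)
  where
  open ≤-Reasoning
  X me SG SH : ℕ
  X = suc e
  me = m * e
  SG = A + me
  SH = A + m * X
  m^[m*e]≢0 : ∀ m → NonZero (m ^ (m * e))
  m^[m*e]≢0 zero    = _
  m^[m*e]≢0 (suc m) = m^n≢0 (suc m) (suc m * e)
  regroup : ∀ p q r s → p * q * (r * s) ≡ p * (q * r) * s
  regroup = solve-∀

-- For positive S, S′: (S , P) ≺ (S′ , P′) iff log S − (log P) / S < log S′ − (log P′) / S′.
infix 4 _≺_
_≺_ : ℕ × ℕ → ℕ × ℕ → Set
(S , P) ≺ (S′ , P′) = S ^ (S * S′) * P′ ^ S < S′ ^ (S * S′) * P ^ S′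

raise-≺ : ∀ A Q m e → 1 ≤ A → 1 ≤ m → suc e ^ A < Q →
          (A + m * e , Q * (e ^ e) ^ m) ≺ (A + m * suc e , Q * (suc e ^ suc e) ^ m)
raise-≺ A Q m e 1≤A 1≤m X^A<Q = begin-strict
  SG ^ (SG * SH) * (Q * (X ^ X) ^ m) ^ SG           ≡⟨ lhs-factor ⟩
  Q ^ SG * ((X ^ A) ^ m * (X ^ me * SG ^ SG) ^ SH)  <⟨ *-monoʳ-< (Q ^ SG) (*-monoˡ-< _ (^-monoˡ-< m X^A<Q)) ⟩
  Q ^ SG * (Q ^ m * (X ^ me * SG ^ SG) ^ SH)        ≤⟨ *-monoʳ-≤ (Q ^ SG) (*-monoʳ-≤ (Q ^ m) (^-monoˡ-≤ SH shift)) ⟩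
  Q ^ SG * (Q ^ m * (e ^ me * SH ^ SG) ^ SH)        ≡⟨ rhs-factor ⟨
  SH ^ (SG * SH) * (Q * (e ^ e) ^ m) ^ SH           ∎
  where
  open ≤-Reasoning
  X me SG SH : ℕ
  X = suc e
  me = m * e
  SG = A + me
  SH = A + m * X
  shift : X ^ me * SG ^ SG ≤ e ^ me * SH ^ SG
  shift = weighted-amgm-shift A m e
  instance
    m≢0 : NonZero m
    m≢0 = >-nonZero 1≤m
    Q^SG≢0 : NonZero (Q ^ SG)
    Q^SG≢0 = m^n≢0 Q SG {{>-nonZero (m<n⇒0<n X^A<Q)}}
    [X^me*SG^SG]^SH≢0 : NonZero ((X ^ me * SG ^ SG) ^ SH)
    [X^me*SG^SG]^SH≢0 =
      m^n≢0 _ SH {{m*n≢0 _ _ {{m^n≢0 X me}} {{m^n≢0 SG SG {{>-nonZero (≤-trans 1≤A (m≤m+n A me))}}}}}}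

  exponents : ((X ^ X) ^ m) ^ SG ≡ (X ^ me) ^ SH * (X ^ A) ^ m
  exponents = begin-equality
    ((X ^ X) ^ m) ^ SG            ≡⟨ trans (cong (_^ SG) (^-*-assoc X X m)) (^-*-assoc X (X * m) SG) ⟩
    X ^ (X * m * SG)              ≡⟨ cong (X ^_) (count A m e) ⟩
    X ^ (me * SH + A * m)         ≡⟨ ^-distribˡ-+-* X (me * SH) (A * m) ⟩
    X ^ (me * SH) * X ^ (A * m)   ≡⟨ cong₂ _*_ (^-*-assoc X me SH) (^-*-assoc X A m) ⟨
    (X ^ me) ^ SH * (X ^ A) ^ m   ∎
    where
    count : ∀ A m e → suc e * m * (A + m * e) ≡ m * e * (A + m * suc e) + A * m
    count = solve-∀

  lhs-factor : SG ^ (SG * SH) * (Q * (X ^ X) ^ m) ^ SG ≡ Q ^ SG * ((X ^ A) ^ m * (X ^ me * SG ^ SG) ^ SH)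
  lhs-factor = begin-equality
    SG ^ (SG * SH) * (Q * (X ^ X) ^ m) ^ SG
      ≡⟨ cong₂ _*_ (sym (^-*-assoc SG SG SH)) (^-distribʳ-* Q _ SG) ⟩
    (SG ^ SG) ^ SH * (Q ^ SG * ((X ^ X) ^ m) ^ SG)
      ≡⟨ cong (λ u → (SG ^ SG) ^ SH * (Q ^ SG * u)) exponents ⟩
    (SG ^ SG) ^ SH * (Q ^ SG * ((X ^ me) ^ SH * (X ^ A) ^ m))
      ≡⟨ shuffle ((SG ^ SG) ^ SH) (Q ^ SG) ((X ^ me) ^ SH) ((X ^ A) ^ m) ⟩
    Q ^ SG * ((X ^ A) ^ m * ((X ^ me) ^ SH * (SG ^ SG) ^ SH))
      ≡⟨ cong (λ u → Q ^ SG * ((X ^ A) ^ m * u)) (^-distribʳ-* (X ^ me) (SG ^ SG) SH) ⟨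
    Q ^ SG * ((X ^ A) ^ m * (X ^ me * SG ^ SG) ^ SH) ∎
    where
    shuffle : ∀ p q r s → p * (q * (r * s)) ≡ q * (s * (r * p))
    shuffle = solve-∀

  rhs-factor : SH ^ (SG * SH) * (Q * (e ^ e) ^ m) ^ SH ≡ Q ^ SG * (Q ^ m * (e ^ me * SH ^ SG) ^ SH)
  rhs-factor = begin-equality
    SH ^ (SG * SH) * (Q * (e ^ e) ^ m) ^ SH
      ≡⟨ cong₂ _*_ (sym (^-*-assoc SH SG SH)) (^-distribʳ-* Q _ SH) ⟩
    (SH ^ SG) ^ SH * (Q ^ SH * ((e ^ e) ^ m) ^ SH)
      ≡⟨ cong₂ (λ u v → (SH ^ SG) ^ SH * (u * v ^ SH))
               (trans (cong (Q ^_) (SH≡SG+m A m e)) (^-distribˡ-+-* Q SG m))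
               (trans (^-*-assoc e e m) (cong (e ^_) (*-comm e m))) ⟩
    (SH ^ SG) ^ SH * ((Q ^ SG * Q ^ m) * (e ^ me) ^ SH)
      ≡⟨ shuffle ((SH ^ SG) ^ SH) (Q ^ SG) (Q ^ m) ((e ^ me) ^ SH) ⟩
    Q ^ SG * (Q ^ m * ((e ^ me) ^ SH * (SH ^ SG) ^ SH))
      ≡⟨ cong (λ u → Q ^ SG * (Q ^ m * u)) (^-distribʳ-* (e ^ me) (SH ^ SG) SH) ⟨
    Q ^ SG * (Q ^ m * (e ^ me * SH ^ SG) ^ SH) ∎
    where
    SH≡SG+m : ∀ A m e → A + m * suc e ≡ A + m * e + m
    SH≡SG+m = solve-∀
    shuffle : ∀ p q r s → p * ((q * r) * s) ≡ q * (r * (s * p))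
    shuffle = solve-∀

maximum-map≤ : ∀ {A : Set} (f : A → ℕ) {M} xs → (∀ x → f x ≤ M) → maximum (map f xs) ≤ M
maximum-map≤ f []       _     = z≤n
maximum-map≤ f (x ∷ xs) bound = ⊔-lub (bound x) (maximum-map≤ f xs bound)

≤maximum-map : ∀ {A : Set} (f : A → ℕ) {x} xs → x ∈ xs → f x ≤ maximum (map f xs)
≤maximum-map f (y ∷ ys) (here refl) = m≤m⊔n (f y) _
≤maximum-map f (y ∷ ys) (there x∈)  = m≤n⇒m≤o⊔n (f y) (≤maximum-map f ys x∈)

maximum-map≡ : ∀ {A : Set} (f : A → ℕ) {M x} xs → (∀ y → f y ≤ M) → x ∈ xs → f x ≡ M →
               maximum (map f xs) ≡ M
maximum-map≡ f xs bound x∈ fx≡M =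
  ≤-antisym (maximum-map≤ f xs bound) (subst (_≤ maximum (map f xs)) fx≡M (≤maximum-map f xs x∈))

map-allFin : ∀ {A : Set} n (f : ℕ → A) → map (f ∘ toℕ) (allFin n) ≡ applyUpTo f n
map-allFin n f = trans (map-tabulate id (f ∘ toℕ)) (tabulate-toℕ n f)
  where
  tabulate-toℕ : ∀ n (f : ℕ → _) → tabulate (f ∘ toℕ {n}) ≡ applyUpTo f n
  tabulate-toℕ zero    f = refl
  tabulate-toℕ (suc n) f = cong (f 0 ∷_) (tabulate-toℕ n (f ∘ suc))

applyUpTo-+ : ∀ {A : Set} (f : ℕ → A) m k →
              applyUpTo f (m + k) ≡ applyUpTo f m ++ applyUpTo (f ∘ (m +_)) k
applyUpTo-+ f zero    k = refl
applyUpTo-+ f (suc m) k = cong (f 0 ∷_) (applyUpTo-+ (f ∘ suc) m k)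

applyUpTo-cong : ∀ {A : Set} {f g : ℕ → A} k → (∀ {i} → i < k → f i ≡ g i) →
                 applyUpTo f k ≡ applyUpTo g k
applyUpTo-cong zero    _   = refl
applyUpTo-cong (suc k) f≡g = cong₂ _∷_ (f≡g z<s) (applyUpTo-cong k (f≡g ∘ s<s))

applyUpTo-const : ∀ {A : Set} {f : ℕ → A} {v} k → (∀ i → f i ≡ v) → applyUpTo f k ≡ replicate k v
applyUpTo-const zero    _    = refl
applyUpTo-const (suc k) f≡v = cong₂ _∷_ (f≡v 0) (applyUpTo-const k (f≡v ∘ suc))

-- Distance and acyclicity of a graph from local data

module Distance {n} (G : Graph n) (δ : Fin n → Fin n → ℕ)
  (δ-refl : ∀ u → δ u u ≡ 0)
  (δ-edge : ∀ u {v w} → G v w ≡ true → δ u w ≤ suc (δ u v))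
  (δ-step : ∀ {u w} → u ≢ w → ∃[ v ] G v w ≡ true × suc (δ u v) ≡ δ u w)
  where

  δ≡0⇒≡ : ∀ {u w} → δ u w ≡ 0 → u ≡ w
  δ≡0⇒≡ {u} {w} δ≡0 with u ≟ᶠ w
  ... | yes u≡w = u≡w
  ... | no  u≢w = let (_ , _ , eq) = δ-step u≢w in contradiction (trans eq δ≡0) λ ()

  reach⇒δ≤ : ∀ k {u w} → T (reach G k u w) → δ u w ≤ k
  reach⇒δ≤ zero {u} r with refl ← toWitness r = ≤-reflexive (δ-refl u)
  reach⇒δ≤ (suc k) {u} r with T-∨ .to r
  ... | inj₁ r′ = m≤n⇒m≤1+n (reach⇒δ≤ k r′)
  ... | inj₂ r′ with (v , r″) ← satisfied (any⁻ _ (allFin n) r′) with (ruv , gvw) ← T-∧ .to r″ =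
    ≤-trans (δ-edge u (T-≡ .to gvw)) (s≤s (reach⇒δ≤ k ruv))

  δ≤⇒reach : ∀ k {u w} → δ u w ≤ k → T (reach G k u w)
  δ≤⇒reach zero    δ≤0 = fromWitness (δ≡0⇒≡ (n≤0⇒n≡0 δ≤0))
  δ≤⇒reach (suc k) {u} {w} δ≤1+k with m≤n⇒m<n∨m≡n δ≤1+k
  ... | inj₁ δ<1+k = T-∨ .from (inj₁ (δ≤⇒reach k (≤-pred δ<1+k)))
  ... | inj₂ δ≡1+k with (v , gvw , eq) ← δ-step (λ { refl → 0≢1+n (trans (sym (δ-refl u)) δ≡1+k) }) =
    T-∨ .from (inj₂ (any⁺ _ (tabulate⁺ v (T-∧ .from (δ≤⇒reach k δuv≤k , T-≡ .from gvw)))))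
    where
    δuv≤k : δ u v ≤ k
    δuv≤k = ≤-reflexive (suc-injective (trans eq δ≡1+k))

  distSearch≡δ : ∀ f k {u w} → k ≤ δ u w → δ u w < k + f → distSearch G u w k f ≡ δ u w
  distSearch≡δ zero    k {u} {w} k≤δ δ<k+0 =
    contradiction (subst (δ u w <_) (+-identityʳ k) δ<k+0) (≤⇒≯ k≤δ)
  distSearch≡δ (suc f) k {u} {w} k≤δ δ<k+1+f with reach G k u w in eq
  ... | true  = ≤-antisym k≤δ (reach⇒δ≤ k (subst T (sym eq) _))
  ... | false = distSearch≡δ f (suc k) k<δ (subst (δ u w <_) (+-suc k f) δ<k+1+f)
    where
    k<δ : k < δ u w
    k<δ = ≤∧≢⇒< k≤δ λ k≡δ → subst T eq (δ≤⇒reach k (≤-reflexive (sym k≡δ)))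

  dist≡δ : ∀ u w → δ u w < n → dist G u w ≡ δ u w
  dist≡δ u w δ<n = distSearch≡δ n 0 z≤n δ<n

  connected : (∀ u w → δ u w ≤ n) → Connected G
  connected δ≤n u w = T-≡ .to (δ≤⇒reach n (δ≤n u w))

module Graded {n} (G : Graph n) (depth : Fin n → ℕ)
  (edge-depth : ∀ {u v} → G u v ≡ true → depth v ≡ suc (depth u) ⊎ depth u ≡ suc (depth v))
  (unique-parent : ∀ {u v w} → G u v ≡ true → G v w ≡ true →
                   depth v ≡ suc (depth u) → depth v ≡ suc (depth w) → u ≡ w)
  where

  Down : Fin n → Fin n → Set
  Down u v = depth v ≡ suc (depth u)

  ¬Down-both : ∀ {u v} → Down u v → Down v u → ⊥
  ¬Down-both uv vu = <-asym (≤-reflexive (sym uv)) (≤-reflexive (sym vu))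

  down-continues : ∀ {a b c} → G a b ≡ true → G b c ≡ true → a ≢ c → Down a b → Down b c
  down-continues gab gbc a≢c ab with edge-depth gbc
  ... | inj₁ bc = bc
  ... | inj₂ cb = contradiction (unique-parent gab gbc ab cb) a≢c

  NonBacktracking : List (Fin n) → Set
  NonBacktracking (a ∷ b ∷ c ∷ l) = a ≢ c × NonBacktracking (b ∷ c ∷ l)
  NonBacktracking _               = ⊤

  Descending : List (Fin n) → Set
  Descending (a ∷ b ∷ l) = Down a b × Descending (b ∷ l)
  Descending _           = ⊤

  Ascending : List (Fin n) → Set
  Ascending (a ∷ b ∷ l) = Down b a × Ascending (b ∷ l)
  Ascending _           = ⊤

  EndsDescending : List (Fin n) → Set
  EndsDescending (a ∷ b ∷ [])    = Down a b
  EndsDescending (a ∷ b ∷ c ∷ l) = EndsDescending (b ∷ c ∷ l)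
  EndsDescending _               = ⊥

  descending : ∀ a b l → Linked G (a ∷ b ∷ l) → NonBacktracking (a ∷ b ∷ l) →
               Down a b → Descending (a ∷ b ∷ l)
  descending a b []      _           _          ab = ab , _
  descending a b (c ∷ l) (gab , walk) (a≢c , nb) ab =
    ab , descending b c l walk nb (down-continues gab (proj₁ walk) a≢c ab)

  ascending-or-endsDescending : ∀ a b l → Linked G (a ∷ b ∷ l) → NonBacktracking (a ∷ b ∷ l) →
                                Ascending (a ∷ b ∷ l) ⊎ EndsDescending (a ∷ b ∷ l)
  ascending-or-endsDescending a b [] (gab , _) _ with edge-depth gab
  ... | inj₁ ab = inj₂ ab
  ... | inj₂ ba = inj₁ (ba , _)
  ascending-or-endsDescending a b (c ∷ l) (gab , walk) (a≢c , nb)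
    with ascending-or-endsDescending b c l walk nb
  ... | inj₂ ends = inj₂ ends
  ... | inj₁ asc@(cb , _) with edge-depth gab
  ...   | inj₁ ab = contradiction cb (¬Down-both (down-continues gab (proj₁ walk) a≢c ab))
  ...   | inj₂ ba = inj₁ (ba , asc)

  descending⇒deeper : ∀ a l → Descending (a ∷ l) → All (λ z → depth a < depth z) l
  descending⇒deeper a []      _         = []
  descending⇒deeper a (b ∷ l) (ab , ds) =
    ≤-reflexive (sym ab) ∷ All.map (<-trans (≤-reflexive (sym ab))) (descending⇒deeper b l ds)

  ascending⇒shallower : ∀ a l → Ascending (a ∷ l) → All (λ z → depth z < depth a) l
  ascending⇒shallower a []      _         = []
  ascending⇒shallower a (b ∷ l) (ba , as) =
    ≤-reflexive (sym ba) ∷ All.map (λ z<b → <-trans z<b (≤-reflexive (sym ba)))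
                                   (ascending⇒shallower b l as)

  closed-nonBacktracking : ∀ a b c l z → Unique (a ∷ b ∷ c ∷ l) → All (z ≢_) (b ∷ c ∷ l) →
                           NonBacktracking (a ∷ b ∷ c ∷ (l ∷ʳ z))
  closed-nonBacktracking a b c []      z ((_ ∷ a≢c ∷ _) ∷ _) (z≢b ∷ _)  = a≢c , ≢-sym z≢b , _
  closed-nonBacktracking a b c (e ∷ l) z ((_ ∷ a≢c ∷ _) ∷ u) (_ ∷ z∉)  =
    a≢c , closed-nonBacktracking b c e l z u z∉

  last-step : ∀ a b c l z → Linked G (a ∷ b ∷ c ∷ (l ∷ʳ z)) →
              EndsDescending (a ∷ b ∷ c ∷ (l ∷ʳ z)) →
              ∃[ y ] y ∈ c ∷ l × G y z ≡ true × Down y z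
  last-step a b c []      z (_ , _ , gcz , _) cz   = c , here refl , gcz , cz
  last-step a b c (e ∷ l) z (_ , walk)        ends =
    let (y , y∈ , gyz , yz) = last-step b c e l z walk ends in y , there y∈ , gyz , yz

  -- Going down and then up again means returning to the unique parent, so a non-backtracking
  -- walk first ascends and then descends; around a cycle the closing step makes it monotone.
  acyclic : HasCycle G → ⊥
  acyclic (x , [] , s≤s () , _)
  acyclic (x , v ∷ [] , s≤s (s≤s ()) , _)
  acyclic (x , v ∷ w ∷ r , _ , uniq@(x∉ ∷ v∉ ∷ _) , walk) =
    [ not-ascending , not-endsDescending ] (ascending-or-endsDescending x v (w ∷ r ∷ʳ x) walk nb)
    where
    nb : NonBacktracking (x ∷ v ∷ w ∷ r ∷ʳ x)
    nb = closed-nonBacktracking x v w r x uniq x∉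
    x∈ : x ∈ v ∷ w ∷ r ∷ʳ x
    x∈ = ∈-++⁺ʳ (v ∷ w ∷ r) (here refl)
    not-ascending : Ascending (x ∷ v ∷ w ∷ r ∷ʳ x) → ⊥
    not-ascending asc = <-irrefl refl (All.lookup (ascending⇒shallower x _ asc) x∈)
    not-endsDescending : EndsDescending (x ∷ v ∷ w ∷ r ∷ʳ x) → ⊥
    not-endsDescending ends with (y , y∈ , gyx , yx) ← last-step x v w r x walk ends =
      <-irrefl refl (All.lookup (descending⇒deeper x _ (descending x v _ walk nb xv)) x∈)
      where
      xv : Down x v
      xv = down-continues gyx (proj₁ walk) (≢-sym (All.lookup v∉ y∈)) yx

-- Eccentricities of the vertices of a path

pathEccs : ℕ → List ℕ
pathEccs d = applyUpTo (λ x → x ⊔ (d ∸ x)) (suc d)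

pathEccs-+2 : ∀ d → pathEccs (2 + d) ≡ (2 + d) ∷ map suc (pathEccs d) ∷ʳ (2 + d)
pathEccs-+2 d = cong (2 + d ∷_) (begin
  applyUpTo (g ∘ suc) (2 + d)               ≡⟨ applyUpTo-∷ʳ (g ∘ suc) (suc d) ⟨
  applyUpTo (g ∘ suc) (suc d) ∷ʳ g (2 + d)  ≡⟨ cong₂ _∷ʳ_ inner outer ⟩
  map suc (pathEccs d) ∷ʳ (2 + d)           ∎)
  where
  open ≡-Reasoning
  g : ℕ → ℕ
  g x = x ⊔ (2 + d ∸ x)
  inner : applyUpTo (g ∘ suc) (suc d) ≡ map suc (pathEccs d)
  inner = trans (applyUpTo-cong (suc d) λ {i} i<1+d → cong (suc i ⊔_) (+-∸-assoc 1 (≤-pred i<1+d)))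
                (sym (map-applyUpTo (λ x → x ⊔ (d ∸ x)) suc (suc d)))
  outer : g (2 + d) ≡ 2 + d
  outer = trans (cong (2 + d ⊔_) (n∸n≡0 (2 + d))) (⊔-identityʳ (2 + d))

length-pathEccs : ∀ d → length (pathEccs d) ≡ suc d
length-pathEccs d = length-applyUpTo (λ x → x ⊔ (d ∸ x)) (suc d)

sum-map-suc : ∀ xs → sum (map suc xs) ≡ length xs + sum xs
sum-map-suc []       = refl
sum-map-suc (x ∷ xs) =
  cong suc (trans (cong (x +_) (sum-map-suc xs)) (+-CS.x∙yz≈y∙xz x (length xs) (sum xs)))

4*sum-pathEccs≥ : ∀ d → 3 * d * d + 4 * d ≤ 4 * sum (pathEccs d)
4*sum-pathEccs≥ zero          = z≤n
4*sum-pathEccs≥ (suc zero)    = n≤1+n 7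
4*sum-pathEccs≥ (suc (suc d)) = begin
  3 * (2 + d) * (2 + d) + 4 * (2 + d)  ≡⟨ expand d ⟩
  (3 * d * d + 4 * d) + (12 * d + 20)  ≤⟨ +-monoˡ-≤ _ (4*sum-pathEccs≥ d) ⟩
  4 * A + (12 * d + 20)                ≡⟨ collect d A ⟩
  4 * ((2 + d) + ((suc d + A) + ((2 + d) + 0))) ≡⟨ cong (4 *_) sum≡ ⟨
  4 * sum (pathEccs (2 + d))           ∎
  where
  open ≤-Reasoning
  A : ℕ
  A = sum (pathEccs d)
  sum≡ : sum (pathEccs (2 + d)) ≡ (2 + d) + ((suc d + A) + ((2 + d) + 0))
  sum≡ = begin-equality
    sum (pathEccs (2 + d))                          ≡⟨ cong sum (pathEccs-+2 d) ⟩
    (2 + d) + sum (map suc (pathEccs d) ∷ʳ (2 + d))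
      ≡⟨ cong (2 + d +_) (sum-++ (map suc (pathEccs d)) (2 + d ∷ [])) ⟩
    (2 + d) + (sum (map suc (pathEccs d)) + ((2 + d) + 0))
      ≡⟨ cong (λ s → 2 + d + (s + (2 + d + 0)))
              (trans (sum-map-suc (pathEccs d)) (cong (_+ A) (length-pathEccs d))) ⟩
    (2 + d) + ((suc d + A) + ((2 + d) + 0))         ∎
  expand : ∀ d → 3 * (2 + d) * (2 + d) + 4 * (2 + d) ≡ (3 * d * d + 4 * d) + (12 * d + 20)
  expand = solve-∀
  collect : ∀ d A → 4 * A + (12 * d + 20) ≡ 4 * ((2 + d) + ((1 + d + A) + ((2 + d) + 0)))
  collect = solve-∀

-- 3d² + 4d − 2(d + 5)(d + 1) = d² − 8d − 10 is positive from d = 10 on.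
mean-pathEccs : ∀ d k → 10 ≤ d → 2 * k ≤ suc d → (2 + k) * suc d < sum (pathEccs d)
mean-pathEccs d k 10≤d 2k≤1+d = *-cancelˡ-< 4 _ _ (begin-strict
  4 * ((2 + k) * suc d)               ≡⟨ regroup k d ⟩
  2 * (4 + 2 * k) * suc d             ≤⟨ *-monoˡ-≤ (suc d) (*-monoʳ-≤ 2 (+-monoʳ-≤ 4 2k≤1+d)) ⟩
  2 * (4 + suc d) * suc d             ≡⟨ cong (λ x → 2 * (4 + suc x) * suc x) d≡10+t ⟩
  2 * (4 + suc (10 + t)) * suc (10 + t)
    <⟨ m<m+n _ z<s ⟩
  2 * (4 + suc (10 + t)) * suc (10 + t) + suc (9 + 12 * t + t * t)
    ≡⟨ excess t ⟩
  3 * (10 + t) * (10 + t) + 4 * (10 + t) ≡⟨ cong (λ x → 3 * x * x + 4 * x) d≡10+t ⟨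
  3 * d * d + 4 * d                   ≤⟨ 4*sum-pathEccs≥ d ⟩
  4 * sum (pathEccs d)                ∎)
  where
  open ≤-Reasoning
  t : ℕ
  t = d ∸ 10
  d≡10+t : d ≡ 10 + t
  d≡10+t = sym (m+[n∸m]≡n 10≤d)
  regroup : ∀ k d → 4 * ((2 + k) * suc d) ≡ 2 * (4 + 2 * k) * suc d
  regroup = solve-∀
  excess : ∀ t → 2 * (4 + suc (10 + t)) * suc (10 + t) + suc (9 + 12 * t + t * t)
               ≡ 3 * (10 + t) * (10 + t) + 4 * (10 + t)
  excess = solve-∀

∣m-1+n∣≤1+∣m-n∣ : ∀ m n → ∣ m - suc n ∣ ≤ suc ∣ m - n ∣
∣m-1+n∣≤1+∣m-n∣ zero    n       = ≤-refl
∣m-1+n∣≤1+∣m-n∣ (suc m) zero    = ≤-trans (≤-reflexive (∣-∣-identityʳ m)) (m≤n⇒m≤1+n (n≤1+n m))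
∣m-1+n∣≤1+∣m-n∣ (suc m) (suc n) = ∣m-1+n∣≤1+∣m-n∣ m n

∣m-n∣≤1+∣m-1+n∣ : ∀ m n → ∣ m - n ∣ ≤ suc ∣ m - suc n ∣
∣m-n∣≤1+∣m-1+n∣ zero    n       = m≤n⇒m≤1+n (n≤1+n n)
∣m-n∣≤1+∣m-1+n∣ (suc m) zero    = s≤s (≤-reflexive (sym (∣-∣-identityʳ m)))
∣m-n∣≤1+∣m-1+n∣ (suc m) (suc n) = ∣m-n∣≤1+∣m-1+n∣ m n

m≤n⇒∣m-1+n∣≡1+∣m-n∣ : ∀ {m n} → m ≤ n → ∣ m - suc n ∣ ≡ suc ∣ m - n ∣
m≤n⇒∣m-1+n∣≡1+∣m-n∣ {zero}  _         = refl
m≤n⇒∣m-1+n∣≡1+∣m-n∣ {suc m} (s≤s m≤n) = m≤n⇒∣m-1+n∣≡1+∣m-n∣ m≤n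

n<m⇒1+∣m-1+n∣≡∣m-n∣ : ∀ {m n} → n < m → suc ∣ m - suc n ∣ ≡ ∣ m - n ∣
n<m⇒1+∣m-1+n∣≡∣m-n∣ {suc m} {zero}  _         = cong suc (∣-∣-identityʳ m)
n<m⇒1+∣m-1+n∣≡∣m-n∣ {suc m} {suc n} (s<s n<m) = n<m⇒1+∣m-1+n∣≡∣m-n∣ n<m

-- starPath n d is pathWithStarAt n d (d / 2).
pathWithStarAt : (n d c : ℕ) → Graph n
pathWithStarAt n d c i j =
  ((a ≤ᵇ d) ∧ (b ≤ᵇ d) ∧ ((suc a ≡ᵇ b) ∨ (suc b ≡ᵇ a)))
  ∨ ((a ≡ᵇ c) ∧ (d <ᵇ b))
  ∨ ((b ≡ᵇ c) ∧ (d <ᵇ a))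
  where
  a b : ℕ
  a = toℕ i
  b = toℕ j

module PathWithStar (n d c : ℕ) (0<c : 0 < c) (c<d : c < d) (d<n : d < n) where

  G : Graph n
  G = pathWithStarAt n d c

  c≤d : c ≤ d
  c≤d = <⇒≤ c<d

  data Child : ℕ → ℕ → Set where
    along   : ∀ {a} → suc a ≤ d → Child a (suc a)
    pendant : ∀ {b} → d < b → Child c b

  Adjacent : ℕ → ℕ → Set
  Adjacent a b = Child a b ⊎ Child b a

  Edge : ℕ → ℕ → Set
  Edge a b = (a ≤ d × b ≤ d × (suc a ≡ b ⊎ suc b ≡ a)) ⊎ (a ≡ c × d < b) ⊎ (b ≡ c × d < a)

  -- pathWithStarAt n d c i j is definitionally does (edge? (toℕ i) (toℕ j)).
  edge? : ∀ a b → Dec (Edge a b)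
  edge? a b = (a ≤? d ×-dec b ≤? d ×-dec (suc a ≟ b ⊎-dec suc b ≟ a))
              ⊎-dec (a ≟ c ×-dec d <? b) ⊎-dec (b ≟ c ×-dec d <? a)

  edge⇒adjacent : ∀ {a b} → Edge a b → Adjacent a b
  edge⇒adjacent (inj₁ (_ , b≤d , inj₁ refl)) = inj₁ (along b≤d)
  edge⇒adjacent (inj₁ (a≤d , _ , inj₂ refl)) = inj₂ (along a≤d)
  edge⇒adjacent (inj₂ (inj₁ (refl , d<b)))   = inj₁ (pendant d<b)
  edge⇒adjacent (inj₂ (inj₂ (refl , d<a)))   = inj₂ (pendant d<a)

  adjacent⇒edge : ∀ {a b} → Adjacent a b → Edge a b
  adjacent⇒edge (inj₁ (along p))   = inj₁ (≤-trans (n≤1+n _) p , p , inj₁ refl)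
  adjacent⇒edge (inj₂ (along p))   = inj₁ (p , ≤-trans (n≤1+n _) p , inj₂ refl)
  adjacent⇒edge (inj₁ (pendant q)) = inj₂ (inj₁ (refl , q))
  adjacent⇒edge (inj₂ (pendant q)) = inj₂ (inj₂ (refl , q))

  adjacent : ∀ {i j} → G i j ≡ true → Adjacent (toℕ i) (toℕ j)
  adjacent {i} {j} g = edge⇒adjacent (invert (subst (Reflects _) g (proof (edge? (toℕ i) (toℕ j)))))

  adjacent⁻¹ : ∀ {i j} → Adjacent (toℕ i) (toℕ j) → G i j ≡ true
  adjacent⁻¹ {i} {j} adj = dec-true (edge? (toℕ i) (toℕ j)) (adjacent⇒edge adj)

  child-irrefl : ∀ {a} → ¬ Child a a
  child-irrefl (pendant d<c) = <-asym d<c c<d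

  isSimple : IsSimple G
  isSimple = (λ i j → does-⇔ (mk⇔ edge-sym edge-sym) (edge? (toℕ i) (toℕ j)) (edge? (toℕ j) (toℕ i)))
           , (λ i → dec-false (edge? (toℕ i) (toℕ i)) ([ child-irrefl , child-irrefl ] ∘ edge⇒adjacent))
    where
    edge-sym : ∀ {a b} → Edge a b → Edge b a
    edge-sym = adjacent⇒edge ∘ swap ∘ edge⇒adjacent

  data Place (a : ℕ) : Set where
    onPath : a ≤ d → Place a
    leaf   : d < a → Place a

  place : ∀ a → Place a
  place a with a ≤? d
  ... | yes a≤d = onPath a≤d
  ... | no  a≰d = leaf (≰⇒> a≰d)

  place-onPath : ∀ {a} (a≤d : a ≤ d) → place a ≡ onPath a≤d
  place-onPath {a} a≤d with a ≤? d
  ... | yes a≤d′ = cong onPath (≤-irrelevant a≤d′ a≤d)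
  ... | no  a≰d  = contradiction a≤d a≰d

  place-leaf : ∀ {a} (d<a : d < a) → place a ≡ leaf d<a
  place-leaf {a} d<a with a ≤? d
  ... | yes a≤d = contradiction a≤d (<⇒≱ d<a)
  ... | no  a≰d = cong leaf (<-irrelevant (≰⇒> a≰d) d<a)

  distance : ∀ {a b} → Place a → Place b → ℕ
  distance {a} {b} (onPath _) (onPath _) = ∣ a - b ∣
  distance {a}     (onPath _) (leaf _)   = suc ∣ a - c ∣
  distance {b = b} (leaf _)   (onPath _) = suc ∣ c - b ∣
  distance {a} {b} (leaf _)   (leaf _)   = if does (a ≟ b) then 0 else 2

  δ : ℕ → ℕ → ℕ
  δ a b = distance (place a) (place b)

  δ-path-path : ∀ {a b} → a ≤ d → b ≤ d → δ a b ≡ ∣ a - b ∣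
  δ-path-path p q rewrite place-onPath p | place-onPath q = refl

  δ-path-leaf : ∀ {a b} → a ≤ d → d < b → δ a b ≡ suc ∣ a - c ∣
  δ-path-leaf p q rewrite place-onPath p | place-leaf q = refl

  δ-leaf-path : ∀ {a b} → d < a → b ≤ d → δ a b ≡ suc ∣ c - b ∣
  δ-leaf-path p q rewrite place-leaf p | place-onPath q = refl

  δ-leaf-leaf : ∀ {a b} → d < a → d < b → a ≢ b → δ a b ≡ 2
  δ-leaf-leaf {a} {b} p q a≢b rewrite place-leaf p | place-leaf q | dec-false (a ≟ b) a≢b = refl

  δ-leaf-leaf≤2 : ∀ {a b} → d < a → d < b → δ a b ≤ 2
  δ-leaf-leaf≤2 {a} {b} p q rewrite place-leaf p | place-leaf q with does (a ≟ b)
  ... | true  = z≤n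
  ... | false = ≤-refl

  δ-refl : ∀ a → δ a a ≡ 0
  δ-refl a with ≤-<-connex a d
  ... | inj₁ p = trans (δ-path-path p p) (∣n-n∣≡0 a)
  ... | inj₂ q rewrite place-leaf q | dec-true (a ≟ a) refl = refl

  δ-child : ∀ a {x y} → Child x y → δ a y ≤ suc (δ a x) × δ a x ≤ suc (δ a y)
  δ-child a (along {x} p) with ≤-<-connex a d
  ... | inj₁ q rewrite δ-path-path q p | δ-path-path q (<⇒≤ p) =
    ∣m-1+n∣≤1+∣m-n∣ a x , ∣m-n∣≤1+∣m-1+n∣ a x
  ... | inj₂ q rewrite δ-leaf-path q p | δ-leaf-path q (<⇒≤ p) =
    s≤s (∣m-1+n∣≤1+∣m-n∣ c x) , s≤s (∣m-n∣≤1+∣m-1+n∣ c x)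
  δ-child a (pendant p) with ≤-<-connex a d
  ... | inj₁ q rewrite δ-path-leaf q p | δ-path-path q c≤d = ≤-refl , m≤n⇒m≤1+n (n≤1+n _)
  ... | inj₂ q rewrite δ-leaf-path q c≤d | ∣n-n∣≡0 c = δ-leaf-leaf≤2 q p , s≤s z≤n

  closer-on-path : ∀ x b → x ≤ d → b ≤ d → x ≢ b →
                   ∃[ w ] w ≤ d × Adjacent w b × suc ∣ x - w ∣ ≡ ∣ x - b ∣
  closer-on-path x b x≤d b≤d x≢b with <-cmp x b
  ... | tri≈ _ x≡b _ = contradiction x≡b x≢b
  closer-on-path x (suc w) _ b≤d _ | tri< x<b _ _ =
    w , <⇒≤ b≤d , inj₁ (along b≤d) , sym (m≤n⇒∣m-1+n∣≡1+∣m-n∣ (≤-pred x<b))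
  closer-on-path x b x≤d _ _ | tri> _ _ b<x =
    suc b , ≤-trans b<x x≤d , inj₂ (along (≤-trans b<x x≤d)) , n<m⇒1+∣m-1+n∣≡∣m-n∣ b<x

  closer-neighbour : ∀ a b → a < n → a ≢ b → ∃[ w ] w < n × Adjacent w b × suc (δ a w) ≡ δ a b
  closer-neighbour a b a<n a≢b with ≤-<-connex a d | ≤-<-connex b d
  ... | inj₁ p | inj₁ q with (w , w≤d , adj , eq) ← closer-on-path a b p q a≢b =
    w , ≤-<-trans w≤d d<n , adj ,
    trans (cong suc (δ-path-path p w≤d)) (trans eq (sym (δ-path-path p q)))
  ... | inj₁ p | inj₂ q =
    c , <-trans c<d d<n , inj₁ (pendant q) , trans (cong suc (δ-path-path p c≤d)) (sym (δ-path-leaf p q))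
  ... | inj₂ p | inj₂ q =
    c , <-trans c<d d<n , inj₁ (pendant q) ,
    trans (cong suc (trans (δ-leaf-path p c≤d) (cong suc (∣n-n∣≡0 c)))) (sym (δ-leaf-leaf p q a≢b))
  ... | inj₂ p | inj₁ q with c ≟ b
  ...   | yes refl = a , a<n , inj₂ (pendant p) ,
                     trans (cong suc (δ-refl a)) (sym (trans (δ-leaf-path p q) (cong suc (∣n-n∣≡0 c))))
  ...   | no  c≢b with (w , w≤d , adj , eq) ← closer-on-path c b c≤d q c≢b =
    w , ≤-<-trans w≤d d<n , adj ,
    trans (cong suc (δ-leaf-path p w≤d)) (trans (cong suc eq) (sym (δ-leaf-path p q)))

  E : ℕ → ℕ
  E a = δ a 0 ⊔ δ a d

  leafEcc : ℕ
  leafEcc = suc (c ⊔ (d ∸ c))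

  E-path : ∀ {a} → a ≤ d → E a ≡ a ⊔ (d ∸ a)
  E-path {a} p = cong₂ _⊔_ (trans (δ-path-path p z≤n) (∣-∣-identityʳ a))
                           (trans (δ-path-path p ≤-refl) (m≤n⇒∣m-n∣≡n∸m p))

  E-leaf : ∀ {a} → d < a → E a ≡ leafEcc
  E-leaf p = cong₂ _⊔_ (trans (δ-leaf-path p z≤n) (cong suc (∣-∣-identityʳ c)))
                       (trans (δ-leaf-path p ≤-refl) (cong suc (m≤n⇒∣m-n∣≡n∸m c≤d)))

  ∣a-b∣≤a⊔[d∸a] : ∀ a {b} → b ≤ d → ∣ a - b ∣ ≤ a ⊔ (d ∸ a)
  ∣a-b∣≤a⊔[d∸a] a {b} b≤d with ∣m-n∣≡[m∸n]∨[n∸m] a b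
  ... | inj₁ eq = subst (_≤ _) (sym eq) (≤-trans (m∸n≤m a b) (m≤m⊔n a (d ∸ a)))
  ... | inj₂ eq = subst (_≤ _) (sym eq) (≤-trans (∸-monoˡ-≤ a b≤d) (m≤n⊔m a (d ∸ a)))

  1+∣a-c∣≤a⊔[d∸a] : ∀ a → suc ∣ a - c ∣ ≤ a ⊔ (d ∸ a)
  1+∣a-c∣≤a⊔[d∸a] a with ≤-total c a
  ... | inj₁ c≤a = subst (λ x → suc x ≤ _) (sym (m≤n⇒∣n-m∣≡n∸m c≤a))
                         (≤-trans (∸-monoʳ-< 0<c c≤a) (m≤m⊔n a (d ∸ a)))
  ... | inj₂ a≤c = subst (λ x → suc x ≤ _) (sym (m≤n⇒∣m-n∣≡n∸m a≤c))
                         (≤-trans (∸-monoˡ-< c<d a≤c) (m≤n⊔m a (d ∸ a)))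

  δ≤E : ∀ a b → δ a b ≤ E a
  δ≤E a b with ≤-<-connex a d | ≤-<-connex b d
  ... | inj₁ p | inj₁ q rewrite E-path p | δ-path-path p q = ∣a-b∣≤a⊔[d∸a] a q
  ... | inj₁ p | inj₂ q rewrite E-path p | δ-path-leaf p q = 1+∣a-c∣≤a⊔[d∸a] a
  ... | inj₂ p | inj₁ q rewrite E-leaf p | δ-leaf-path p q = s≤s (∣a-b∣≤a⊔[d∸a] c q)
  ... | inj₂ p | inj₂ q rewrite E-leaf p = ≤-trans (δ-leaf-leaf≤2 p q) (s≤s (m≤n⇒m≤n⊔o _ 0<c))

  E≤d : ∀ a → E a ≤ d
  E≤d a with ≤-<-connex a d
  ... | inj₁ p rewrite E-path p = ⊔-lub p (m∸n≤m d a)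
  ... | inj₂ p rewrite E-leaf p = ⊔-lub c<d (∸-monoʳ-< 0<c c≤d)

  δᶠ : Fin n → Fin n → ℕ
  δᶠ u v = δ (toℕ u) (toℕ v)

  δᶠ-edge : ∀ u {v w} → G v w ≡ true → δᶠ u w ≤ suc (δᶠ u v)
  δᶠ-edge u {v} {w} g with adjacent {v} {w} g
  ... | inj₁ vw = proj₁ (δ-child (toℕ u) vw)
  ... | inj₂ wv = proj₂ (δ-child (toℕ u) wv)

  δᶠ-step : ∀ {u w} → u ≢ w → ∃[ v ] G v w ≡ true × suc (δᶠ u v) ≡ δᶠ u w
  δᶠ-step {u} {w} u≢w
    with (x , x<n , adj , eq) ← closer-neighbour (toℕ u) (toℕ w) (toℕ<n u) (u≢w ∘ toℕ-injective) =
    fromℕ< x<n , adjacent⁻¹ (subst (λ y → Adjacent y (toℕ w)) (sym (toℕ-fromℕ< x<n)) adj) ,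
    trans (cong (suc ∘ δ (toℕ u)) (toℕ-fromℕ< x<n)) eq

  open Distance G δᶠ (δ-refl ∘ toℕ) δᶠ-edge δᶠ-step using (dist≡δ; connected)

  δᶠ<n : ∀ u v → δᶠ u v < n
  δᶠ<n u v = ≤-<-trans (≤-trans (δ≤E (toℕ u) (toℕ v)) (E≤d (toℕ u))) d<n

  0<n : 0 < n
  0<n = ≤-<-trans z≤n d<n

  0ᶠ dᶠ : Fin n
  0ᶠ = fromℕ< 0<n
  dᶠ = fromℕ< d<n

  farthest : ∀ a → ∃[ u ] δ a (toℕ u) ≡ E a
  farthest a with ⊔-sel (δ a 0) (δ a d)
  ... | inj₁ eq = 0ᶠ , trans (cong (δ a) (toℕ-fromℕ< 0<n)) (sym eq)
  ... | inj₂ eq = dᶠ , trans (cong (δ a) (toℕ-fromℕ< d<n)) (sym eq)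

  ecc≡E : ∀ v → ecc G v ≡ E (toℕ v)
  ecc≡E v with (u , δvu≡E) ← farthest (toℕ v) =
    trans (cong maximum (map-cong (λ w → dist≡δ v w (δᶠ<n v w)) (allFin n)))
          (maximum-map≡ (δᶠ v) (allFin n) (δ≤E (toℕ v) ∘ toℕ) (∈-allFin u) δvu≡E)

  diameter≡d : diameter G ≡ d
  diameter≡d = trans (cong maximum (map-cong ecc≡E (allFin n)))
                     (maximum-map≡ (E ∘ toℕ) (allFin n) (E≤d ∘ toℕ) (∈-allFin 0ᶠ)
                                   (trans (cong E (toℕ-fromℕ< 0<n)) (E-path z≤n)))

  depth : Fin n → ℕ
  depth u = δ 0 (toℕ u)

  child-depth : ∀ {a b} → Child a b → δ 0 b ≡ suc (δ 0 a)
  child-depth (along p)   = trans (δ-path-path z≤n p) (cong suc (sym (δ-path-path z≤n (<⇒≤ p))))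
  child-depth (pendant q) = trans (δ-path-leaf z≤n q) (cong suc (sym (δ-path-path z≤n c≤d)))

  parents-agree : ∀ {a a′ b} → Child a b → Child a′ b → a ≡ a′
  parents-agree (along _)   (along _)   = refl
  parents-agree (along p)   (pendant q) = contradiction p (<⇒≱ q)
  parents-agree (pendant q) (along p)   = contradiction p (<⇒≱ q)
  parents-agree (pendant _) (pendant _) = refl

  downward⇒child : ∀ {a b} → Adjacent a b → δ 0 b ≡ suc (δ 0 a) → Child a b
  downward⇒child (inj₁ ab) _   = ab
  downward⇒child (inj₂ ba) a<b = contradiction (≤-reflexive (sym (child-depth ba))) (<-asym (≤-reflexive (sym a<b)))

  edge-depth : ∀ {u v} → G u v ≡ true → depth v ≡ suc (depth u) ⊎ depth u ≡ suc (depth v)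
  edge-depth {u} {v} g = Sum.map child-depth child-depth (adjacent {u} {v} g)

  unique-parent : ∀ {u v w} → G u v ≡ true → G v w ≡ true →
                  depth v ≡ suc (depth u) → depth v ≡ suc (depth w) → u ≡ w
  unique-parent {u} {v} {w} guv gvw uv wv =
    toℕ-injective (parents-agree (downward⇒child (adjacent {u} {v} guv) uv)
                                 (downward⇒child (swap (adjacent {v} {w} gvw)) wv))

  open Graded G depth (λ {u} {v} → edge-depth {u} {v}) (λ {u} {v} {w} → unique-parent {u} {v} {w})
    using (acyclic)

  isTree : IsTree G
  isTree = isSimple , connected (λ u w → <⇒≤ (δᶠ<n u w)) , acyclic

  m : ℕ
  m = n ∸ suc d

  eccs≡ : map (ecc G) (allFin n) ≡ pathEccs d ++ replicate m leafEcc
  eccs≡ = begin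
    map (ecc G) (allFin n)                               ≡⟨ map-cong ecc≡E (allFin n) ⟩
    map (E ∘ toℕ) (allFin n)                             ≡⟨ map-allFin n E ⟩
    applyUpTo E n                                        ≡⟨ cong (applyUpTo E) (m+[n∸m]≡n d<n) ⟨
    applyUpTo E (suc d + m)                              ≡⟨ applyUpTo-+ E (suc d) m ⟩
    applyUpTo E (suc d) ++ applyUpTo (E ∘ (suc d +_)) m
      ≡⟨ cong₂ _++_ (applyUpTo-cong (suc d) (E-path ∘ ≤-pred))
                    (applyUpTo-const m λ i → E-leaf (s≤s (m≤m+n d i))) ⟩
    pathEccs d ++ replicate m leafEcc                    ∎
    where open ≡-Reasoning

  eccSum≡ : eccSum G ≡ sum (pathEccs d) + m * leafEcc
  eccSum≡ = trans (cong sum eccs≡)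
                  (trans (sum-++ (pathEccs d) _) (cong (sum (pathEccs d) +_) (sum-replicate m leafEcc)))

  eccPowProd≡ : eccPowProd G ≡ selfPowProduct (pathEccs d) * (leafEcc ^ leafEcc) ^ m
  eccPowProd≡ = begin
    eccPowProd G                                                  ≡⟨ cong product (map-∘ (allFin n)) ⟩
    selfPowProduct (map (ecc G) (allFin n))                       ≡⟨ cong selfPowProduct eccs≡ ⟩
    selfPowProduct (pathEccs d ++ replicate m leafEcc)
      ≡⟨ cong product (map-++ self^ (pathEccs d) _) ⟩
    product (map self^ (pathEccs d) ++ map self^ (replicate m leafEcc))
      ≡⟨ product-++ (map self^ (pathEccs d)) _ ⟩
    selfPowProduct (pathEccs d) * selfPowProduct (replicate m leafEcc)
      ≡⟨ cong (λ xs → selfPowProduct (pathEccs d) * product xs) (map-replicate self^ m leafEcc) ⟩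
    selfPowProduct (pathEccs d) * product (replicate m (leafEcc ^ leafEcc))
      ≡⟨ cong (selfPowProduct (pathEccs d) *_) (product-replicate m (leafEcc ^ leafEcc)) ⟩
    selfPowProduct (pathEccs d) * (leafEcc ^ leafEcc) ^ m         ∎
    where
    open ≡-Reasoning
    self^ : ℕ → ℕ
    self^ x = x ^ x

-- Moving the centre of the star off the middle of the path

module Halves (d : ℕ) (10≤d : 10 ≤ d) where

  h r k : ℕ
  h = d / 2
  r = d % 2
  k = d ∸ h

  d≡r+h+h : d ≡ r + h + h
  d≡r+h+h = trans (m≡m%n+[m/n]*n d 2) (regroup r h)
    where
    regroup : ∀ r h → r + h * 2 ≡ r + h + h
    regroup = solve-∀

  k≡r+h : k ≡ r + h
  k≡r+h = trans (cong (_∸ h) d≡r+h+h) (m+n∸n≡m (r + h) h)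

  5≤h : 5 ≤ h
  5≤h = /-monoˡ-≤ 2 10≤d

  h≤k : h ≤ k
  h≤k = subst (h ≤_) (sym k≡r+h) (m≤n+m h r)

  h<d : h < d
  h<d = subst (h <_) (sym d≡r+h+h) (≤-<-trans (m≤n+m h r) (m<m+n (r + h) (≤-trans z<s 5≤h)))

  2k≤1+d : 2 * k ≤ suc d
  2k≤1+d = begin
    2 * k                ≡⟨ cong (2 *_) k≡r+h ⟩
    2 * (r + h)          ≡⟨ regroup r h ⟩
    r + (r + h + h)      ≤⟨ +-monoˡ-≤ (r + h + h) (≤-pred (m%n<n d 2)) ⟩
    suc (r + h + h)      ≡⟨ cong suc d≡r+h+h ⟨
    suc d                ∎
    where
    open ≤-Reasoning
    regroup : ∀ r h → 2 * (r + h) ≡ r + (r + h + h)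
    regroup = solve-∀

  centre-ecc : h ⊔ (d ∸ h) ≡ k
  centre-ecc = m≤n⇒m⊔n≡n h≤k

  shifted-ecc : (h ∸ 1) ⊔ (d ∸ (h ∸ 1)) ≡ suc k
  shifted-ecc = trans (cong (h ∸ 1 ⊔_) far) (m≤n⇒m⊔n≡n (≤-trans (m∸n≤m h 1) (m≤n⇒m≤1+n h≤k)))
    where
    far : d ∸ (h ∸ 1) ≡ suc k
    far = trans (cong (suc d ∸_) (m+[n∸m]≡n (≤-trans z<s 5≤h))) (+-∸-assoc 1 (<⇒≤ h<d))

module Construction (d n : ℕ) (10≤d : 10 ≤ d) (d+2≤n : d + 2 ≤ n) where

  open Halves d 10≤d

  1+d<n : suc d < n
  1+d<n = subst (_≤ n) (+-comm d 2) d+2≤n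

  d<n : d < n
  d<n = <-trans (n<1+n d) 1+d<n

  module S = PathWithStar n d h (≤-trans z<s 5≤h) h<d d<n
  module T = PathWithStar n d (h ∸ 1) (∸-monoˡ-≤ 1 (≤-trans (s≤s (s≤s z≤n)) 5≤h))
                          (≤-<-trans (m∸n≤m h 1) h<d) d<n

  A Q m : ℕ
  A = sum (pathEccs d)
  Q = selfPowProduct (pathEccs d)
  m = n ∸ suc d

  mean : (2 + k) * length (pathEccs d) < A
  mean = subst (λ l → (2 + k) * l < A) (sym (length-pathEccs d)) (mean-pathEccs d k 10≤d 2k≤1+d)

  profile : ∀ {G : Graph n} {e e′} → eccSum G ≡ A + m * e → eccPowProd G ≡ Q * (e ^ e) ^ m → e ≡ e′ →
            (eccSum G , eccPowProd G) ≡ (A + m * e′ , Q * (e′ ^ e′) ^ m)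
  profile s p refl = cong₂ _,_ s p

  starPath-IeccLt-T : starPath n d IeccLt T.G
  starPath-IeccLt-T =
    subst₂ _≺_ (sym (profile S.eccSum≡ S.eccPowProd≡ (cong suc centre-ecc)))
               (sym (profile T.eccSum≡ T.eccPowProd≡ (cong suc shifted-ecc)))
               (raise-≺ A Q m (suc k) (≤-trans (s≤s z≤n) mean) (m<n⇒0<n∸m 1+d<n)
                        (e^sum<selfPowProduct (2 + k) (pathEccs d) mean))

corollary25 : Σ ℕ λ d₀ → (d n : ℕ) → d₀ ≤ d → d + 2 ≤ n →
    Σ (Graph n) λ T → IsTree T × diameter T ≡ d × (starPath n d IeccLt T)
corollary25 = 10 , λ d n 10≤d d+2≤n →
  let open Construction d n 10≤d d+2≤n in T.G , T.isTree , T.diameter≡d , starPath-IeccLt-T
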